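{- Let $B>0$, $W\ge1$, and let $\mathbf a'=(a_1,a_2,a_3,a_4)\in(\mathbb{Z}\setminus\{0\})^4$ be such that $\overline{A}(W,\mathbf a',B)$ is nonempty. Then for all pairwise distinct $i,j,k,l\in\{1,2,3,4\}$, $$|a_i^2a_j^2a_k^2a_l^{ -1}|\le W^3B\qquad\text{and}\qquad |a_i|\le W|B_{jk}|.$$
   Context: Convention $a_{ji}=a_{ij}$. $B_{ij}=(B|a_1a_2a_3a_4|)^{1/3}/(a_ia_j)$. $\overline{A}(W,\mathbf a',B)$ is the set of $(a_{12},a_{13},a_{14},a_{23},a_{24},a_{34})\in(\mathbb{Z}\setminus\{0\})^6$ such that: $|a_{ij}a_ja_{jk}a_ka_{kl}|\le B$ for all pairwise distinct $i,j,k,l$; the torsor equations $a_4a_{14}-a_3a_{13}+a_2a_{12}=0$, $a_4a_{24}-a_3a_{23}+a_1a_{12}=0$, $a_4a_{34}-a_2a_{23}+a_1a_{13}=0$, $a_3a_{34}-a_2a_{24}+a_1a_{14}=0$, $a_{12}a_{34}-a_{13}a_{24}+a_{23}a_{14}=0$ hold; $\gcd(a_i,a_j)=\gcd(a_i,a_{jk})=\gcd(a_{ij},a_{ik})=1$ for pairwise distinct $i,j,k$; $|a_ia_ja_k|\le|a_{ij}a_{ik}a_{jk}|$ for pairwise distinct $i,j,k$; and $|a_{ij}|\le W|B_{ij}|$ for all six pairs.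
   Formalization: The parameters B and W range over the rationals, subject to $B>0$ and $W\ge1$. -}

module Defs where

open import Data.Fin using (Fin; zero; suc)
open import Data.Integer as ℤ using (ℤ; +_; 0ℤ; 1ℤ)
open import Data.Integer.GCD using (gcd)
open import Data.Nat as ℕ using (ℕ)
open import Data.Rational as ℚ using (ℚ; _/_)
open import Data.Product using (_×_; _,_)
open import Relation.Binary.PropositionalEquality using (_≡_; _≢_)
open import Relation.Nullary using (¬_)

-- Indices 1,2,3,4 of the paper are Fin 4 values 0,1,2,3.

absQ : ℤ → ℚ
absQ z = (+ ℤ.∣ z ∣) / 1

cube : ℚ → ℚ
cube q = q ℚ.* q ℚ.* q

Six : Set
Six = ℤ × ℤ × ℤ × ℤ × ℤ × ℤ

-- the symmetric convention a_ji = a_ij; diagonal entries are never used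
sym6 : Six → Fin 4 → Fin 4 → ℤ
sym6 (a12 , a13 , a14 , a23 , a24 , a34) = go
  where
  go : Fin 4 → Fin 4 → ℤ
  go zero (suc zero) = a12
  go zero (suc (suc zero)) = a13
  go zero (suc (suc (suc zero))) = a14
  go (suc zero) (suc (suc zero)) = a23
  go (suc zero) (suc (suc (suc zero))) = a24
  go (suc (suc zero)) (suc (suc (suc zero))) = a34
  go (suc zero) zero = a12
  go (suc (suc zero)) zero = a13
  go (suc (suc (suc zero))) zero = a14
  go (suc (suc zero)) (suc zero) = a23
  go (suc (suc (suc zero))) (suc zero) = a24
  go (suc (suc (suc zero))) (suc (suc zero)) = a34
  go _ _ = 0ℤ

Distinct3 : Fin 4 → Fin 4 → Fin 4 → Set
Distinct3 i j k = i ≢ j × i ≢ k × j ≢ k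

Distinct4 : Fin 4 → Fin 4 → Fin 4 → Fin 4 → Set
Distinct4 i j k l = i ≢ j × i ≢ k × i ≢ l × j ≢ k × j ≢ l × k ≢ l

module _ (a : Fin 4 → ℤ) where
  a₁ a₂ a₃ a₄ : ℤ
  a₁ = a zero
  a₂ = a (suc zero)
  a₃ = a (suc (suc zero))
  a₄ = a (suc (suc (suc zero)))

  prod4 : ℤ
  prod4 = a₁ ℤ.* a₂ ℤ.* a₃ ℤ.* a₄

  -- The condition |a_ij| ≤ W |B_ij| with B_ij = (B|a1a2a3a4|)^{1/3}/(a_i a_j)
  -- is stated in the equivalent cube-root-free form
  --   |a_ij a_i a_j|^3 ≤ W^3 B |a1a2a3a4|   (both sides are nonnegative).
  record InAbar (W B : ℚ) (t : Six) : Set where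
    private
      x = sym6 t
      a12 = x zero (suc zero)
      a13 = x zero (suc (suc zero))
      a14 = x zero (suc (suc (suc zero)))
      a23 = x (suc zero) (suc (suc zero))
      a24 = x (suc zero) (suc (suc (suc zero)))
      a34 = x (suc (suc zero)) (suc (suc (suc zero)))
    field
      nonzero : ∀ i j → i ≢ j → x i j ≢ 0ℤ
      height : ∀ i j k l → Distinct4 i j k l →
        absQ (x i j ℤ.* a j ℤ.* x j k ℤ.* a k ℤ.* x k l) ℚ.≤ B
      torsor1 : a₄ ℤ.* a14 ℤ.- a₃ ℤ.* a13 ℤ.+ a₂ ℤ.* a12 ≡ 0ℤ
      torsor2 : a₄ ℤ.* a24 ℤ.- a₃ ℤ.* a23 ℤ.+ a₁ ℤ.* a12 ≡ 0ℤ
      torsor3 : a₄ ℤ.* a34 ℤ.- a₂ ℤ.* a23 ℤ.+ a₁ ℤ.* a13 ≡ 0ℤ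
      torsor4 : a₃ ℤ.* a34 ℤ.- a₂ ℤ.* a24 ℤ.+ a₁ ℤ.* a14 ≡ 0ℤ
      torsor5 : a12 ℤ.* a34 ℤ.- a13 ℤ.* a24 ℤ.+ a23 ℤ.* a14 ≡ 0ℤ
      coprime-aa : ∀ i j k → Distinct3 i j k → gcd (a i) (a j) ≡ 1ℤ
      coprime-ax : ∀ i j k → Distinct3 i j k → gcd (a i) (x j k) ≡ 1ℤ
      coprime-xx : ∀ i j k → Distinct3 i j k → gcd (x i j) (x i k) ≡ 1ℤ
      triangle : ∀ i j k → Distinct3 i j k →
        ℤ.∣ a i ℤ.* a j ℤ.* a k ∣ ℕ.≤ ℤ.∣ x i j ℤ.* x i k ℤ.* x j k ∣
      heightW : ∀ i j → i ≢ j →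
        cube (absQ (x i j ℤ.* a i ℤ.* a j))
          ℚ.≤ cube W ℚ.* B ℚ.* absQ prod4

{-# OPTIONS --safe #-}
-- Multiplying the bounds |aᵢⱼ aᵢ aⱼ|³ ≤ W³B|a₁a₂a₃a₄| for the three pairs inside {i, j, k}
-- bounds (|aᵢⱼ aᵢₖ aⱼₖ| · |aᵢ aⱼ aₖ|²)³; the triangle condition |aᵢ aⱼ aₖ| ≤ |aᵢⱼ aᵢₖ aⱼₖ|
-- turns this into |aᵢ aⱼ aₖ|⁹ ≤ (W³B|a₁a₂a₃a₄|)³, whence the second bound by taking cube
-- roots. Dividing it by |aᵢ aⱼ aₖ| = |a₁a₂a₃a₄| / |aₗ| gives the first.
module Submission where

open import Defs
open import Algebra.Bundles using (CommutativeMonoid)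
open import Data.Fin using (Fin; zero; suc)
open import Data.Fin.Properties using (_≟_; all?; ≤-decTotalOrder)
open import Data.Integer as ℤ using (ℤ; 0ℤ; +_)
import Data.Integer.Properties as ℤP
open import Data.Integer.Tactic.RingSolver using (solve-∀)
open import Data.List using (List; []; _∷_; foldr; map; allFin)
import Data.List.Properties as List
open import Data.List.Relation.Binary.Permutation.Propositional using (↭⇒↭ₛ)
open import Data.List.Relation.Binary.Permutation.Propositional.Properties using (map⁺)
open import Data.List.Relation.Binary.Permutation.Setoid.Properties using (foldr-commMonoid)
open import Data.List.Sort.InsertionSort.Base (≤-decTotalOrder 4) using (sort)
open import Data.List.Sort.InsertionSort.Properties (≤-decTotalOrder 4) using (sort-↭)
import Data.Nat as ℕ
open import Data.Nat.Coprimality using (1-coprimeTo) renaming (sym to coprime-sym)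
open import Data.Product using (_×_; ∃; _,_)
open import Data.Rational as ℚ using (ℚ; 0ℚ; 1ℚ; mkℚ)
import Data.Rational.Properties as ℚP
open import Data.Rational.Solver using (module +-*-Solver)
open import Relation.Binary.PropositionalEquality
  using (_≡_; _≢_; refl; sym; cong; cong₂; subst; module ≡-Reasoning)
open import Relation.Nullary.Decidable using (Dec; ¬?; _×-dec_; _→-dec_; from-yes)

distinct4? : ∀ i j k l → Dec (Distinct4 i j k l)
distinct4? i j k l =
  ¬? (i ≟ j) ×-dec ¬? (i ≟ k) ×-dec ¬? (i ≟ l) ×-dec ¬? (j ≟ k) ×-dec ¬? (j ≟ l) ×-dec ¬? (k ≟ l)

-- Checked by evaluation on all 4⁴ quadruples.
sort-distinct4 : ∀ i j k l → Distinct4 i j k l → sort (i ∷ j ∷ k ∷ l ∷ []) ≡ allFin 4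
sort-distinct4 = from-yes (all? λ i → all? λ j → all? λ k → all? λ l →
  distinct4? i j k l →-dec List.≡-dec _≟_ (sort (i ∷ j ∷ k ∷ l ∷ [])) (allFin 4))

*-foldr₄ : ∀ w x y z → w ℤ.* x ℤ.* y ℤ.* z ≡ w ℤ.* (x ℤ.* (y ℤ.* (z ℤ.* + 1)))
*-foldr₄ = solve-∀

product-distinct4 : (f : Fin 4 → ℤ) → ∀ {i j k l} → Distinct4 i j k l →
  f i ℤ.* f j ℤ.* f k ℤ.* f l
    ≡ f zero ℤ.* f (suc zero) ℤ.* f (suc (suc zero)) ℤ.* f (suc (suc (suc zero)))
product-distinct4 f {i} {j} {k} {l} ijkl-distinct = begin
  f i ℤ.* f j ℤ.* f k ℤ.* f l                    ≡⟨ *-foldr₄ (f i) (f j) (f k) (f l) ⟩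
  product (i ∷ j ∷ k ∷ l ∷ [])                   ≡⟨ foldr-commMonoid ℤ*.setoid ℤ*.isCommutativeMonoid
                                                      (↭⇒↭ₛ (map⁺ f (sort-↭ (i ∷ j ∷ k ∷ l ∷ [])))) ⟨
  product (sort (i ∷ j ∷ k ∷ l ∷ []))            ≡⟨ cong product (sort-distinct4 i j k l ijkl-distinct) ⟩
  product (allFin 4)                             ≡⟨ *-foldr₄ (f zero) (f (suc zero))
                                                      (f (suc (suc zero))) (f (suc (suc (suc zero)))) ⟨
  f zero ℤ.* f (suc zero) ℤ.* f (suc (suc zero)) ℤ.* f (suc (suc (suc zero))) ∎
  where
  open ≡-Reasoning
  module ℤ* = CommutativeMonoid ℤP.*-1-commutativeMonoid
  product : List (Fin 4) → ℤ
  product is = foldr ℤ._*_ (+ 1) (map f is)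

absQ≡mkℚ : ∀ z → absQ z ≡ mkℚ (+ ℤ.∣ z ∣) 0 (coprime-sym (1-coprimeTo ℤ.∣ z ∣))
absQ≡mkℚ z = ℚP.normalize-coprime _

absQ-* : ∀ u v → absQ (u ℤ.* v) ≡ absQ u ℚ.* absQ v
absQ-* u v = begin
  absQ (u ℤ.* v)                        ≡⟨ cong (λ n → + n ℚ./ 1) (ℤP.abs-* u v) ⟩
  + (ℤ.∣ u ∣ ℕ.* ℤ.∣ v ∣) ℚ./ 1          ≡⟨ cong (ℚ._/ 1) (ℤP.pos-* ℤ.∣ u ∣ ℤ.∣ v ∣) ⟩
  (+ ℤ.∣ u ∣ ℤ.* + ℤ.∣ v ∣) ℚ./ 1        ≡⟨ cong₂ ℚ._*_ (absQ≡mkℚ u) (absQ≡mkℚ v) ⟨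
  absQ u ℚ.* absQ v                     ∎
  where open ≡-Reasoning

absQ-*₃ : ∀ u v w → absQ (u ℤ.* v ℤ.* w) ≡ absQ u ℚ.* absQ v ℚ.* absQ w
absQ-*₃ u v w = begin
  absQ (u ℤ.* v ℤ.* w)          ≡⟨ absQ-* (u ℤ.* v) w ⟩
  absQ (u ℤ.* v) ℚ.* absQ w     ≡⟨ cong (ℚ._* absQ w) (absQ-* u v) ⟩
  absQ u ℚ.* absQ v ℚ.* absQ w  ∎
  where open ≡-Reasoning

absQ-mono-≤ : ∀ {u v} → ℤ.∣ u ∣ ℕ.≤ ℤ.∣ v ∣ → absQ u ℚ.≤ absQ v
absQ-mono-≤ {u} {v} ∣u∣≤∣v∣ rewrite absQ≡mkℚ u | absQ≡mkℚ v =
  ℚ.*≤* (ℤP.*-monoʳ-≤-nonNeg (+ 1) (ℤ.+≤+ ∣u∣≤∣v∣))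

absQ-mono-< : ∀ {u v} → ℤ.∣ u ∣ ℕ.< ℤ.∣ v ∣ → absQ u ℚ.< absQ v
absQ-mono-< {u} {v} ∣u∣<∣v∣ rewrite absQ≡mkℚ u | absQ≡mkℚ v =
  ℚ.*<* (ℤP.*-monoʳ-<-pos (+ 1) (ℤ.+<+ ∣u∣<∣v∣))

absQ-nonNeg : ∀ z → 0ℚ ℚ.≤ absQ z
absQ-nonNeg z = absQ-mono-≤ {0ℤ} {z} ℕ.z≤n

absQ-pos : ∀ z .{{_ : ℤ.NonZero z}} → ℚ.Positive (absQ z)
absQ-pos z = ℚ.positive (absQ-mono-< {0ℤ} {z} (ℕ.>-nonZero⁻¹ ℤ.∣ z ∣))

*-mono-≤-nonNeg : ∀ {p q r s} → 0ℚ ℚ.≤ q → 0ℚ ℚ.≤ r → p ℚ.≤ q → r ℚ.≤ s → p ℚ.* r ℚ.≤ q ℚ.* s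
*-mono-≤-nonNeg {q = q} {r = r} 0≤q 0≤r p≤q r≤s = ℚP.≤-trans
  (ℚP.*-monoʳ-≤-nonNeg r {{ℚ.nonNegative 0≤r}} p≤q)
  (ℚP.*-monoˡ-≤-nonNeg q {{ℚ.nonNegative 0≤q}} r≤s)

cube-nonNeg : ∀ {p} → 0ℚ ℚ.≤ p → 0ℚ ℚ.≤ cube p
cube-nonNeg {p} 0≤p = *-mono-≤-nonNeg 0≤p² ℚP.≤-refl 0≤p² 0≤p
  where
  0≤p² : 0ℚ ℚ.≤ p ℚ.* p
  0≤p² = *-mono-≤-nonNeg 0≤p ℚP.≤-refl 0≤p 0≤p

cube-mono-< : ∀ {p q} → 0ℚ ℚ.≤ p → p ℚ.< q → cube p ℚ.< cube q
cube-mono-< {p} {q} 0≤p p<q = ℚP.≤-<-trans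
  (ℚP.*-monoʳ-≤-nonNeg p {{ℚ.nonNegative 0≤p}} (*-mono-≤-nonNeg 0≤q 0≤p p≤q p≤q))
  (ℚP.*-monoʳ-<-pos (q ℚ.* q) {{ℚP.pos*pos⇒pos q q}} p<q)
  where
  p≤q : p ℚ.≤ q
  p≤q = ℚP.<⇒≤ p<q
  0≤q : 0ℚ ℚ.≤ q
  0≤q = ℚP.≤-trans 0≤p p≤q
  instance
    q-pos : ℚ.Positive q
    q-pos = ℚ.positive (ℚP.≤-<-trans 0≤p p<q)

cube-cancel-≤ : ∀ {p q} → 0ℚ ℚ.≤ q → cube p ℚ.≤ cube q → p ℚ.≤ q
cube-cancel-≤ 0≤q p³≤q³ =
  ℚP.≮⇒≥ λ q<p → ℚP.<-irrefl refl (ℚP.<-≤-trans (cube-mono-< 0≤q q<p) p³≤q³)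

cube-* : ∀ p q r → cube (p ℚ.* q ℚ.* r) ≡ cube p ℚ.* cube q ℚ.* cube r
cube-* = solve 3 (λ p q r →
    (p :* q :* r) :* (p :* q :* r) :* (p :* q :* r) := (p :* p :* p) :* (q :* q :* q) :* (r :* r :* r))
  refl
  where open +-*-Solver

*-≤-of-cubes-≤ : ∀ {u v w z} → 0ℚ ℚ.≤ u → 0ℚ ℚ.≤ v → 0ℚ ℚ.≤ w →
  cube u ℚ.≤ z → cube v ℚ.≤ z → cube w ℚ.≤ z → u ℚ.* v ℚ.* w ℚ.≤ z
*-≤-of-cubes-≤ {u} {v} {w} {z} 0≤u 0≤v 0≤w u³≤z v³≤z w³≤z = cube-cancel-≤ 0≤z (begin
  cube (u ℚ.* v ℚ.* w)             ≡⟨ cube-* u v w ⟩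
  cube u ℚ.* cube v ℚ.* cube w     ≤⟨ *-mono-≤-nonNeg 0≤z² (cube-nonNeg 0≤w)
                                        (*-mono-≤-nonNeg 0≤z (cube-nonNeg 0≤v) u³≤z v³≤z) w³≤z ⟩
  cube z                           ∎)
  where
  open ℚP.≤-Reasoning
  0≤z : 0ℚ ℚ.≤ z
  0≤z = ℚP.≤-trans (cube-nonNeg 0≤u) u³≤z
  0≤z² : 0ℚ ℚ.≤ z ℚ.* z
  0≤z² = *-mono-≤-nonNeg 0≤z ℚP.≤-refl 0≤z 0≤z

cube-≤-of-triangle : ∀ (z : ℚ) (aᵢ aⱼ aₖ xᵢⱼ xᵢₖ xⱼₖ : ℤ) →
  ℤ.∣ aᵢ ℤ.* aⱼ ℤ.* aₖ ∣ ℕ.≤ ℤ.∣ xᵢⱼ ℤ.* xᵢₖ ℤ.* xⱼₖ ∣ →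
  cube (absQ (xᵢⱼ ℤ.* aᵢ ℤ.* aⱼ)) ℚ.≤ z →
  cube (absQ (xᵢₖ ℤ.* aᵢ ℤ.* aₖ)) ℚ.≤ z →
  cube (absQ (xⱼₖ ℤ.* aⱼ ℤ.* aₖ)) ℚ.≤ z →
  cube (absQ (aᵢ ℤ.* aⱼ ℤ.* aₖ)) ℚ.≤ z
cube-≤-of-triangle z aᵢ aⱼ aₖ xᵢⱼ xᵢₖ xⱼₖ triangle hᵢⱼ hᵢₖ hⱼₖ = begin
  α ℚ.* α ℚ.* α                        ≤⟨ ℚP.*-monoʳ-≤-nonNeg α (ℚP.*-monoʳ-≤-nonNeg α α≤ξ) ⟩
  ξ ℚ.* α ℚ.* α                        ≡⟨ absQ-*₃ (xᵢⱼ ℤ.* xᵢₖ ℤ.* xⱼₖ) (aᵢ ℤ.* aⱼ ℤ.* aₖ) (aᵢ ℤ.* aⱼ ℤ.* aₖ) ⟨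
  absQ (xᵢⱼ ℤ.* xᵢₖ ℤ.* xⱼₖ ℤ.* (aᵢ ℤ.* aⱼ ℤ.* aₖ) ℤ.* (aᵢ ℤ.* aⱼ ℤ.* aₖ))
                                       ≡⟨ cong absQ (regroup xᵢⱼ xᵢₖ xⱼₖ aᵢ aⱼ aₖ) ⟩
  absQ (eᵢⱼ ℤ.* eᵢₖ ℤ.* eⱼₖ)            ≡⟨ absQ-*₃ eᵢⱼ eᵢₖ eⱼₖ ⟩
  absQ eᵢⱼ ℚ.* absQ eᵢₖ ℚ.* absQ eⱼₖ      ≤⟨ *-≤-of-cubes-≤ (absQ-nonNeg eᵢⱼ) (absQ-nonNeg eᵢₖ) (absQ-nonNeg eⱼₖ)
                                            hᵢⱼ hᵢₖ hⱼₖ ⟩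
  z                                    ∎
  where
  open ℚP.≤-Reasoning
  α ξ : ℚ
  α = absQ (aᵢ ℤ.* aⱼ ℤ.* aₖ)
  ξ = absQ (xᵢⱼ ℤ.* xᵢₖ ℤ.* xⱼₖ)
  eᵢⱼ eᵢₖ eⱼₖ : ℤ
  eᵢⱼ = xᵢⱼ ℤ.* aᵢ ℤ.* aⱼ
  eᵢₖ = xᵢₖ ℤ.* aᵢ ℤ.* aₖ
  eⱼₖ = xⱼₖ ℤ.* aⱼ ℤ.* aₖ
  α≤ξ : α ℚ.≤ ξ
  α≤ξ = absQ-mono-≤ {aᵢ ℤ.* aⱼ ℤ.* aₖ} {xᵢⱼ ℤ.* xᵢₖ ℤ.* xⱼₖ} triangle
  instance
    α-nonNeg : ℚ.NonNegative α
    α-nonNeg = ℚ.nonNegative (absQ-nonNeg (aᵢ ℤ.* aⱼ ℤ.* aₖ))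
  regroup : ∀ xᵢⱼ xᵢₖ xⱼₖ aᵢ aⱼ aₖ →
    xᵢⱼ ℤ.* xᵢₖ ℤ.* xⱼₖ ℤ.* (aᵢ ℤ.* aⱼ ℤ.* aₖ) ℤ.* (aᵢ ℤ.* aⱼ ℤ.* aₖ)
      ≡ xᵢⱼ ℤ.* aᵢ ℤ.* aⱼ ℤ.* (xᵢₖ ℤ.* aᵢ ℤ.* aₖ) ℤ.* (xⱼₖ ℤ.* aⱼ ℤ.* aₖ)
  regroup = solve-∀

square-≤-of-cube-≤ : ∀ c u v .{{_ : ℤ.NonZero u}} →
  cube (absQ u) ℚ.≤ c ℚ.* absQ (u ℤ.* v) → absQ u ℚ.* absQ u ℚ.≤ c ℚ.* absQ v
square-≤-of-cube-≤ c u v u³≤cuv = ℚP.*-cancelʳ-≤-pos (absQ u) {{absQ-pos u}} (begin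
  absQ u ℚ.* absQ u ℚ.* absQ u         ≤⟨ u³≤cuv ⟩
  c ℚ.* absQ (u ℤ.* v)                 ≡⟨ cong (c ℚ.*_) (absQ-* u v) ⟩
  c ℚ.* (absQ u ℚ.* absQ v)            ≡⟨ rotate c (absQ u) (absQ v) ⟩
  c ℚ.* absQ v ℚ.* absQ u              ∎)
  where
  open ℚP.≤-Reasoning
  rotate : ∀ c x y → c ℚ.* (x ℚ.* y) ≡ c ℚ.* y ℚ.* x
  rotate = solve 3 (λ c x y → c :* (x :* y) := c :* y :* x) refl
    where open +-*-Solver

lemma3p2 : (B W : ℚ) → 0ℚ ℚ.< B → 1ℚ ℚ.≤ W →
    (a : Fin 4 → ℤ) → (∀ i → a i ≢ 0ℤ) →
    ∃ (InAbar a W B) →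
    ∀ i j k l → Distinct4 i j k l →
      (absQ (a i ℤ.* a j ℤ.* a k) ℚ.* absQ (a i ℤ.* a j ℤ.* a k)
          ℚ.≤ cube W ℚ.* B ℚ.* absQ (a l))
      × (cube (absQ (a i ℤ.* a j ℤ.* a k)) ℚ.≤ cube W ℚ.* B ℚ.* absQ (prod4 a))
lemma3p2 B W _ _ a a≢0 (t , t∈A) i j k l ijkl@(i≢j , i≢k , _ , j≢k , _ , _) =
  square-bound , cube-bound
  where
  open InAbar t∈A
  x : Fin 4 → Fin 4 → ℤ
  x = sym6 t
  C : ℚ
  C = cube W ℚ.* B
  aᵢaⱼaₖ : ℤ
  aᵢaⱼaₖ = a i ℤ.* a j ℤ.* a k
  cube-bound : cube (absQ aᵢaⱼaₖ) ℚ.≤ C ℚ.* absQ (prod4 a)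
  cube-bound = cube-≤-of-triangle _ (a i) (a j) (a k) (x i j) (x i k) (x j k)
    (triangle i j k (i≢j , i≢k , j≢k)) (heightW i j i≢j) (heightW i k i≢k) (heightW j k j≢k)
  instance
    a-nonZero : ∀ {m} → ℤ.NonZero (a m)
    a-nonZero {m} = ℤ.≢-nonZero (a≢0 m)
    aᵢaⱼ-nonZero : ℤ.NonZero (a i ℤ.* a j)
    aᵢaⱼ-nonZero = ℤP.i*j≢0 (a i) (a j)
    aᵢaⱼaₖ-nonZero : ℤ.NonZero aᵢaⱼaₖ
    aᵢaⱼaₖ-nonZero = ℤP.i*j≢0 (a i ℤ.* a j) (a k)
  square-bound : absQ aᵢaⱼaₖ ℚ.* absQ aᵢaⱼaₖ ℚ.≤ C ℚ.* absQ (a l)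
  square-bound = square-≤-of-cube-≤ C aᵢaⱼaₖ (a l)
    (subst (λ P → cube (absQ aᵢaⱼaₖ) ℚ.≤ C ℚ.* absQ P) (sym (product-distinct4 a ijkl)) cube-bound)
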